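{- Let $d>4$. Then $\operatorname{Sp}_{2d}(2)$ has a fixed-point subgroup $G$ of order $27$ and exponent $3$ such that the natural module $\mathbb{F}_2^{2d}$, as an $\mathbb{F}_2G$-module, has no trivial composition factor. If $d=4$, then $\operatorname{Sp}_8(2)$ has such a subgroup $G$ of order $9$.
   Context: A subgroup $X\subseteq\operatorname{GL}(V)$ is a fixed-point subgroup if $\det(x-1)=0$ for all $x\in X$. $\operatorname{Sp}_{2d}(2)$ is the symplectic group on $\mathbb{F}_2^{2d}$. -}

module Defs where

open import Data.Bool using (Bool; true; false; _xor_; _∧_)
open import Data.Nat using (ℕ; zero; suc; _+_)
open import Data.Fin using (Fin; splitAt; _≟_)
open import Data.Vec using (Vec; []; _∷_; map; zipWith; foldr′; replicate; tabulate; lookup; transpose; head; tail; removeAt)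
open import Data.List using (List; length)
open import Data.List.Membership.Propositional using (_∈_)
open import Data.List.Relation.Unary.Unique.Propositional using (Unique)
open import Data.Product using (Σ; _×_; ∃; ∃-syntax)
open import Data.Sum using (_⊎_; inj₁; inj₂)
open import Relation.Binary.PropositionalEquality using (_≡_; _≢_)
open import Relation.Nullary using (¬_; does)

-- The field F₂ is Bool with xor as addition and ∧ as multiplication.
Vector : ℕ → Set
Vector n = Vec Bool n

-- A matrix is the vector of its rows.
Matrix : ℕ → Set
Matrix n = Vec (Vector n) n

zeroV : ∀ {n} → Vector n
zeroV = replicate _ false

_+ᵥ_ : ∀ {n} → Vector n → Vector n → Vector n
_+ᵥ_ = zipWith _xor_

dot : ∀ {n} → Vector n → Vector n → Bool
dot u v = foldr′ _xor_ false (zipWith _∧_ u v)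

_·_ : ∀ {n} → Matrix n → Vector n → Vector n
A · v = map (λ row → dot row v) A

_*ᴹ_ : ∀ {n} → Matrix n → Matrix n → Matrix n
A *ᴹ B = map (λ row → map (λ col → dot row col) (transpose B)) A

_+ᴹ_ : ∀ {n} → Matrix n → Matrix n → Matrix n
_+ᴹ_ = zipWith (zipWith _xor_)

identity : ∀ {n} → Matrix n
identity = tabulate λ i → tabulate λ j → does (i ≟ j)

-- Determinant over F₂ by Laplace expansion along the first row
-- (signs are irrelevant in characteristic 2).
det : ∀ {n} → Matrix n → Bool
det {zero} A = true
det {suc n} A =
  foldr′ _xor_ false
    (tabulate λ j → lookup (head A) j ∧ det (map (λ r → removeAt r j) (tail A)))

-- Gram matrix of the standard symplectic form on F₂^(2d):  [[0, I], [I, 0]]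
-- (note -I = I over F₂).
private
  jEntry : ∀ {d} → Fin d ⊎ Fin d → Fin d ⊎ Fin d → Bool
  jEntry (inj₁ a) (inj₂ b) = does (a ≟ b)
  jEntry (inj₂ a) (inj₁ b) = does (a ≟ b)
  jEntry _ _ = false

J : (d : ℕ) → Matrix (d + d)
J d = tabulate λ i → tabulate λ j → jEntry (splitAt d i) (splitAt d j)

IsSymplectic : (d : ℕ) → Matrix (d + d) → Set
IsSymplectic d A = transpose A *ᴹ (J d *ᴹ A) ≡ J d

IsSubgroupOfSp : (d : ℕ) → List (Matrix (d + d)) → Set
IsSubgroupOfSp d G =
  (∀ {x} → x ∈ G → IsSymplectic d x) ×
  (identity ∈ G) ×
  (∀ {x y} → x ∈ G → y ∈ G → (x *ᴹ y) ∈ G) ×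
  (∀ {x} → x ∈ G → ∃[ y ] (y ∈ G × (x *ᴹ y) ≡ identity))

HasOrder : ∀ {n} → List (Matrix n) → ℕ → Set
HasOrder G m = Unique G × length G ≡ m

HasExponent3 : ∀ {n} → List (Matrix n) → Set
HasExponent3 G =
  (∀ {x} → x ∈ G → (x *ᴹ (x *ᴹ x)) ≡ identity) ×
  (∃[ x ] (x ∈ G × x ≢ identity))

-- fixed-point subgroup: det(x - 1) = 0 for all x ∈ G  (x - 1 = x + 1 over F₂)
IsFixedPointSubgroup : ∀ {n} → List (Matrix n) → Set
IsFixedPointSubgroup G = ∀ {x} → x ∈ G → det (x +ᴹ identity) ≡ false

-- F₂-subspaces (scalar multiplication is trivial over F₂) which are G-invariant
IsSubmodule : ∀ {n} → List (Matrix n) → (Vector n → Set) → Set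
IsSubmodule G P =
  P zeroV ×
  (∀ {u v} → P u → P v → P (u +ᵥ v)) ×
  (∀ {g v} → g ∈ G → P v → P (g · v))

-- The F₂G-module F₂^n has the trivial module F₂ as a composition factor,
-- i.e. (Jordan–Hölder) as a subquotient: there are submodules U ⊆ W with
-- W/U one-dimensional (spanned by the class of w) and G acting trivially on W/U.
HasTrivialCompositionFactor : ∀ {n} → List (Matrix n) → Set₁
HasTrivialCompositionFactor {n} G =
  Σ (Vector n → Set) λ U → Σ (Vector n → Set) λ W →
    IsSubmodule G U × IsSubmodule G W ×
    (∀ {v} → U v → W v) ×
    Σ (Vector n) λ w →
      W w × ¬ U w ×
      (∀ {v} → W v → U v ⊎ U (v +ᵥ w)) ×
      (∀ {g} → g ∈ G → U ((g · w) +ᵥ w))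

-- Let ρ : ℤ₃ → Sp₂(2) send 1 to an element of order 3. For characters χ₁, …, χ_d of an elementary
-- abelian 3-group X that separate points, x ↦ diag(ρ(χ₁ x), …, ρ(χ_d x)) embeds X in Sp_{2d}(2).
-- The image is a fixed-point subgroup when the kernels of the χ_k cover X: for X = ℤ₃² the four
-- characters a, b, a + b, a + 2b have the four lines of ℤ₃² as kernels, and for X = ℤ₃³ (d > 4) the
-- character c is added on the remaining blocks. Each χ_k takes every value an odd number of times and
-- 1 + ρ(1) + ρ(2) = 0, so Σ_{g ∈ G} g = 0 and Σ_{g ∈ G} (g − 1) = −|G| = 1 on F₂^{2d}. A trivial
-- composition factor W/U = ⟨w⟩ + U would put every (g − 1) w, hence w itself, into U.

module Submission where

open import Data.Nat using (ℕ; _<_; _+_; zero; suc; s≤s)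
open import Data.List using (List)
open import Data.Product using (Σ; _×_)
open import Relation.Nullary using (¬_)
open import Defs

open import Data.Bool using (Bool; true; false; _xor_; _∧_)
open import Data.Bool.Properties
  using (xor-∧-commutativeRing; xor-comm; xor-same; xor-identityʳ; ∧-identityʳ; ∧-zeroʳ; ∧-assoc; ∧-comm;
         ∧-distribˡ-xor; ∧-distribʳ-xor)
open import Data.Fin using (Fin; zero; suc; splitAt; join; _≟_; _↑ˡ_; _↑ʳ_; punchIn)
open import Data.Fin.Properties
  using (splitAt-join; join-splitAt; splitAt-↑ˡ; splitAt-↑ʳ; punchInᵢ≢i; punchOut-punchIn)
open import Data.List using ([]; _∷_; length; map; foldr; cartesianProduct)
open import Data.List.Properties using (length-map; map-∘; map-cong)
open import Data.List.Membership.Propositional using (_∈_)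
open import Data.List.Membership.Propositional.Properties using (∈-map⁺; ∈-map⁻; ∈-cartesianProduct⁺)
open import Data.List.Relation.Unary.All using ([]; _∷_)
open import Data.List.Relation.Unary.AllPairs using ([]; _∷_)
open import Data.List.Relation.Unary.Any using (here; there)
open import Data.List.Relation.Unary.Unique.Propositional using (Unique)
open import Data.List.Relation.Unary.Unique.Propositional.Properties using (map⁺; cartesianProduct⁺)
open import Data.Maybe using (Maybe; just; nothing)
open import Data.Product using (_,_; proj₁; proj₂; ∃; zip′)
open import Data.Sum using (_⊎_; inj₁; inj₂; swap; reduce; [_,_]′)
open import Data.Sum.Properties using (swap-involutive; ≡-dec)
open import Data.Vec using (Vec; []; _∷_; lookup; tabulate; replicate; transpose; removeAt; _⊛_; foldr′; zipWith)
open import Data.Vec.Properties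
  using (lookup∘tabulate; tabulate∘lookup; tabulate-cong; lookup-map; lookup-zipWith; lookup-replicate;
         lookup-⊛; removeAt-punchOut)
open import Function using (_∘_; _∋_; mk⇔)
open import Relation.Binary.Definitions using (DecidableEquality)
open import Relation.Binary.PropositionalEquality
  using (_≡_; _≢_; refl; sym; trans; cong; cong₂; subst; module ≡-Reasoning)
open import Relation.Nullary using (yes; no; does)
open import Relation.Nullary.Decidable using (does-⇔; dec-true)
open import Tactic.RingSolver using (solve-∀)
open import Tactic.RingSolver.Core.AlmostCommutativeRing using (AlmostCommutativeRing; fromCommutativeRing)

open ≡-Reasoning

F₂ : AlmostCommutativeRing _ _
F₂ = fromCommutativeRing xor-∧-commutativeRing isZero
  where
  isZero : (x : Bool) → Maybe (false ≡ x)
  isZero false = just refl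
  isZero true  = nothing

xor-interchange : ∀ a b c e → (a xor b) xor (c xor e) ≡ (a xor c) xor (b xor e)
xor-interchange = solve-∀ F₂

δ : ∀ {n} → Fin n → Fin n → Bool
δ i j = does (i ≟ j)

δ-refl : ∀ {n} (i : Fin n) → δ i i ≡ true
δ-refl i = dec-true (i ≟ i) refl

δ-sym : ∀ {n} (i j : Fin n) → δ i j ≡ δ j i
δ-sym i j = does-⇔ (mk⇔ sym sym) (i ≟ j) (j ≟ i)

δ-subst : ∀ {n} (f : Fin n → Bool) i j → f i ∧ δ i j ≡ f j ∧ δ i j
δ-subst f i j with i ≟ j
... | yes refl = refl
... | no _     = trans (∧-zeroʳ (f i)) (sym (∧-zeroʳ (f j)))

∑ : ∀ {n} → (Fin n → Bool) → Bool
∑ f = foldr′ _xor_ false (tabulate f)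

∑-cong : ∀ {n} {f g : Fin n → Bool} → (∀ k → f k ≡ g k) → ∑ f ≡ ∑ g
∑-cong f≗g = cong (foldr′ _xor_ false) (tabulate-cong f≗g)

∑-false : ∀ {n} (f : Fin n → Bool) → (∀ k → f k ≡ false) → ∑ f ≡ false
∑-false {zero}  f f≡false = refl
∑-false {suc n} f f≡false = cong₂ _xor_ (f≡false zero) (∑-false (f ∘ suc) (f≡false ∘ suc))

∑-xor : ∀ {n} (f g : Fin n → Bool) → ∑ (λ k → f k xor g k) ≡ ∑ f xor ∑ g
∑-xor {zero}  f g = refl
∑-xor {suc n} f g = trans (cong ((f zero xor g zero) xor_) (∑-xor (f ∘ suc) (g ∘ suc)))
                          (xor-interchange (f zero) (g zero) (∑ (f ∘ suc)) (∑ (g ∘ suc)))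

∑-point : ∀ {n} (b : Bool) (p : Fin n) → ∑ (λ k → b ∧ δ k p) ≡ b
∑-point {suc n} b zero = begin
  (b ∧ true) xor ∑ {n} (λ _ → b ∧ false) ≡⟨ cong₂ _xor_ (∧-identityʳ b) (∑-false {n} _ (λ _ → ∧-zeroʳ b)) ⟩
  b xor false                            ≡⟨ xor-identityʳ b ⟩
  b                                      ∎
∑-point {suc n} b (suc p) = cong₂ _xor_ (∧-zeroʳ b) (∑-point b p)

∑-sift : ∀ {n} (a : Bool) (p : Fin n) (v : Fin n → Bool) → ∑ (λ k → (a ∧ δ k p) ∧ v k) ≡ a ∧ v p
∑-sift a p v = trans (∑-cong sift) (∑-point (a ∧ v p) p)
  where
  sift : ∀ k → (a ∧ δ k p) ∧ v k ≡ (a ∧ v p) ∧ δ k p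
  sift k = begin
    (a ∧ δ k p) ∧ v k ≡⟨ ∧-assoc a (δ k p) (v k) ⟩
    a ∧ (δ k p ∧ v k) ≡⟨ cong (a ∧_) (trans (∧-comm (δ k p) (v k)) (δ-subst v k p)) ⟩
    a ∧ (v p ∧ δ k p) ≡⟨ ∧-assoc a (v p) (δ k p) ⟨
    (a ∧ v p) ∧ δ k p ∎

dot-∑ : ∀ {n} (u v : Vector n) → dot u v ≡ ∑ (λ k → lookup u k ∧ lookup v k)
dot-∑ u v = cong (foldr′ _xor_ false)
  (trans (sym (tabulate∘lookup (zipWith _∧_ u v))) (tabulate-cong (λ k → lookup-zipWith _∧_ k u v)))

dot-two-point : ∀ {n} (u v : Vector n) a b p q →
  (∀ k → lookup u k ≡ (a ∧ δ k p) xor (b ∧ δ k q)) → dot u v ≡ (a ∧ lookup v p) xor (b ∧ lookup v q)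
dot-two-point u v a b p q u≡ = begin
  dot u v
    ≡⟨ dot-∑ u v ⟩
  ∑ (λ k → lookup u k ∧ lookup v k)
    ≡⟨ ∑-cong expand ⟩
  ∑ (λ k → ((a ∧ δ k p) ∧ lookup v k) xor ((b ∧ δ k q) ∧ lookup v k))
    ≡⟨ ∑-xor (λ k → (a ∧ δ k p) ∧ lookup v k) (λ k → (b ∧ δ k q) ∧ lookup v k) ⟩
  ∑ (λ k → (a ∧ δ k p) ∧ lookup v k) xor ∑ (λ k → (b ∧ δ k q) ∧ lookup v k)
    ≡⟨ cong₂ _xor_ (∑-sift a p (lookup v)) (∑-sift b q (lookup v)) ⟩
  (a ∧ lookup v p) xor (b ∧ lookup v q) ∎
  where
  expand : ∀ k → lookup u k ∧ lookup v k ≡ ((a ∧ δ k p) ∧ lookup v k) xor ((b ∧ δ k q) ∧ lookup v k)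
  expand k = trans (cong (_∧ lookup v k) (u≡ k)) (∧-distribʳ-xor (lookup v k) (a ∧ δ k p) (b ∧ δ k q))

xorSum : List Bool → Bool
xorSum = foldr _xor_ false

xorSum-map-xor : ∀ {X : Set} (g h : X → Bool) xs →
  xorSum (map (λ x → g x xor h x) xs) ≡ xorSum (map g xs) xor xorSum (map h xs)
xorSum-map-xor g h []       = refl
xorSum-map-xor g h (x ∷ xs) = trans (cong ((g x xor h x) xor_) (xorSum-map-xor g h xs))
                                    (xor-interchange (g x) (h x) _ _)

xorSum-map-∧ : ∀ {X : Set} a (g : X → Bool) xs → xorSum (map (λ x → a ∧ g x) xs) ≡ a ∧ xorSum (map g xs)
xorSum-map-∧ a g []       = sym (∧-zeroʳ a)
xorSum-map-∧ a g (x ∷ xs) = trans (cong ((a ∧ g x) xor_) (xorSum-map-∧ a g xs)) (sym (∧-distribˡ-xor a _ _))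

entry : ∀ {n} → Matrix n → Fin n → Fin n → Bool
entry A i j = lookup (lookup A i) j

Vec-ext : ∀ {A : Set} {n} (u v : Vec A n) → (∀ i → lookup u i ≡ lookup v i) → u ≡ v
Vec-ext u v u≗v = trans (sym (tabulate∘lookup u)) (trans (tabulate-cong u≗v) (tabulate∘lookup v))

Matrix-ext : ∀ {n} (A B : Matrix n) → (∀ i j → entry A i j ≡ entry B i j) → A ≡ B
Matrix-ext A B A≗B = Vec-ext A B (λ i → Vec-ext _ _ (A≗B i))

entry-tabulate : ∀ {n} (f : Fin n → Fin n → Bool) i j → entry (tabulate λ i → tabulate (f i)) i j ≡ f i j
entry-tabulate f i j = trans (cong (λ r → lookup r j) (lookup∘tabulate _ i)) (lookup∘tabulate (f i) j)

entry-identity : ∀ {n} (i j : Fin n) → entry identity i j ≡ δ i j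
entry-identity = entry-tabulate (λ i j → δ i j)

entry-+ᴹ : ∀ {n} (A B : Matrix n) i j → entry (A +ᴹ B) i j ≡ entry A i j xor entry B i j
entry-+ᴹ A B i j = trans (cong (λ r → lookup r j) (lookup-zipWith (zipWith _xor_) i A B))
                         (lookup-zipWith _xor_ j (lookup A i) (lookup B i))

lookup-transpose : ∀ {m n} (M : Vec (Vector n) m) j → lookup (transpose M) j ≡ Data.Vec.map (λ r → lookup r j) M
lookup-transpose         []      j = lookup-replicate j []
lookup-transpose {suc m} {n} (r ∷ M) j = begin
  lookup (cons ⊛ r ⊛ transpose M) j                   ≡⟨ lookup-⊛ j (cons ⊛ r) (transpose M) ⟩
  lookup (cons ⊛ r) j (lookup (transpose M) j)        ≡⟨ cong (λ h → h (lookup (transpose M) j))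
                                                             (lookup-⊛ j cons r) ⟩
  lookup cons j (lookup r j) (lookup (transpose M) j) ≡⟨ cong (λ h → h (lookup r j) (lookup (transpose M) j))
                                                             (lookup-replicate j (Data.Vec._∷_ {n = m})) ⟩
  lookup r j ∷ lookup (transpose M) j                 ≡⟨ cong (lookup r j ∷_) (lookup-transpose M j) ⟩
  lookup r j ∷ Data.Vec.map (λ r → lookup r j) M      ∎
  where
  cons : Vec (Bool → Vector m → Vector (suc m)) n
  cons = replicate n _∷_

entry-transpose : ∀ {n} (A : Matrix n) i j → entry (transpose A) i j ≡ entry A j i
entry-transpose A i j = trans (cong (λ r → lookup r j) (lookup-transpose A i)) (lookup-map j _ A)

entry-*ᴹ : ∀ {n} (A B : Matrix n) i j → entry (A *ᴹ B) i j ≡ dot (lookup A i) (lookup (transpose B) j)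
entry-*ᴹ A B i j =
  trans (cong (λ r → lookup r j) (lookup-map i _ A)) (lookup-map j (dot (lookup A i)) (transpose B))

lookup-· : ∀ {n} (A : Matrix n) v i → lookup (A · v) i ≡ dot (lookup A i) v
lookup-· A v i = lookup-map i (λ row → dot row v) A

entry-*ᴹ₂ : ∀ (B C : Matrix 2) s t →
  entry (B *ᴹ C) s t ≡ (entry B s zero ∧ entry C zero t) xor (entry B s (suc zero) ∧ entry C (suc zero) t)
entry-*ᴹ₂ B C s t = begin
  entry (B *ᴹ C) s t                               ≡⟨ entry-*ᴹ B C s t ⟩
  dot (lookup B s) (lookup (transpose C) t)         ≡⟨ dot₂ (lookup B s) (lookup (transpose C) t) ⟩
  (entry B s zero ∧ entry (transpose C) t zero) xor (entry B s (suc zero) ∧ entry (transpose C) t (suc zero))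
    ≡⟨ cong₂ (λ x y → (entry B s zero ∧ x) xor (entry B s (suc zero) ∧ y))
             (entry-transpose C t zero) (entry-transpose C t (suc zero)) ⟩
  (entry B s zero ∧ entry C zero t) xor (entry B s (suc zero) ∧ entry C (suc zero) t) ∎
  where
  dot₂ : ∀ (u v : Vector 2) →
    dot u v ≡ (lookup u zero ∧ lookup v zero) xor (lookup u (suc zero) ∧ lookup v (suc zero))
  dot₂ (a ∷ b ∷ []) (c ∷ e ∷ []) = cong ((a ∧ c) xor_) (xor-identityʳ (b ∧ e))

minor : ∀ {n} → Matrix (suc n) → Fin (suc n) → Matrix n
minor (_ ∷ rows) j = Data.Vec.map (λ row → removeAt row j) rows

det-zero-row : ∀ {n} (A : Matrix n) i → (∀ j → entry A i j ≡ false) → det A ≡ false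
det-zero-row (r ∷ A) zero    row≡0 = ∑-false _ (λ j → cong (_∧ det (minor (r ∷ A) j)) (row≡0 j))
det-zero-row (r ∷ A) (suc i) row≡0 = ∑-false _ λ j →
  trans (cong (lookup r j ∧_) (det-zero-row (minor (r ∷ A) j) i (minor-row≡0 j))) (∧-zeroʳ (lookup r j))
  where
  minor-row≡0 : ∀ j l → entry (minor (r ∷ A) j) i l ≡ false
  minor-row≡0 j l = begin
    lookup (lookup (minor (r ∷ A) j) i) l ≡⟨ cong (λ r → lookup r l) (lookup-map i _ A) ⟩
    lookup (removeAt (lookup A i) j) l    ≡⟨ cong (lookup (removeAt (lookup A i) j)) (punchOut-punchIn j) ⟨
    lookup (removeAt (lookup A i) j) _    ≡⟨ removeAt-punchOut (lookup A i) (punchInᵢ≢i j l ∘ sym) ⟩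
    lookup (lookup A i) (punchIn j l)     ≡⟨ row≡0 (punchIn j l) ⟩
    false                                 ∎

det-+ᴹ-equal-rows : ∀ {n} (A B : Matrix n) i → (∀ j → entry A i j ≡ entry B i j) → det (A +ᴹ B) ≡ false
det-+ᴹ-equal-rows A B i rows≡ = det-zero-row (A +ᴹ B) i λ j →
  trans (entry-+ᴹ A B i j) (trans (cong (_xor entry B i j) (rows≡ j)) (xor-same (entry B i j)))

augmentationSum : ∀ {n} → List (Matrix n) → Vector n → Vector n
augmentationSum G w = foldr (λ g acc → ((g · w) +ᵥ w) +ᵥ acc) zeroV G

lookup-augmentationSum : ∀ {n} (G : List (Matrix n)) w i →
  lookup (augmentationSum G w) i ≡ xorSum (map (λ g → lookup (g · w) i xor lookup w i) G)
lookup-augmentationSum []      w i = lookup-replicate i false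
lookup-augmentationSum (g ∷ G) w i =
  trans (lookup-zipWith _xor_ i ((g · w) +ᵥ w) (augmentationSum G w))
        (cong₂ _xor_ (lookup-zipWith _xor_ i (g · w) w) (lookup-augmentationSum G w i))

augmentationSum-closed : ∀ {n} (G : List (Matrix n)) {U : Vector n → Set} {w} →
  U zeroV → (∀ {u v} → U u → U v → U (u +ᵥ v)) → (∀ {g} → g ∈ G → U ((g · w) +ᵥ w)) →
  U (augmentationSum G w)
augmentationSum-closed []      U-zero U-+ defect∈U = U-zero
augmentationSum-closed (g ∷ G) U-zero U-+ defect∈U =
  U-+ (defect∈U (here refl))
      (augmentationSum-closed G U-zero (λ {u} {v} → U-+ {u} {v}) (λ g∈G → defect∈U (there g∈G)))

augmentationSum≡id⇒¬trivialFactor : ∀ {n} (G : List (Matrix n)) →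
  (∀ w → augmentationSum G w ≡ w) → ¬ HasTrivialCompositionFactor G
augmentationSum≡id⇒¬trivialFactor G aug≡id (U , _ , (U-zero , U-+ , _) , _ , _ , w , _ , w∉U , _ , defect∈U) =
  w∉U (subst U (aug≡id w) (augmentationSum-closed G U-zero (λ {u} {v} → U-+ {u} {v}) defect∈U))

module Sparse {n} (σ : Fin n → Fin n) (σ-involutive : ∀ i → σ (σ i) ≡ i) where

  sparse : (Fin n → Bool) → (Fin n → Bool) → Matrix n
  sparse α β = tabulate λ i → tabulate λ j → (α i ∧ δ j i) xor (β i ∧ δ j (σ i))

  entry-sparse : ∀ α β i j → entry (sparse α β) i j ≡ (α i ∧ δ j i) xor (β i ∧ δ j (σ i))
  entry-sparse α β = entry-tabulate (λ i j → (α i ∧ δ j i) xor (β i ∧ δ j (σ i)))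

  sparse-cong : ∀ {α α′ β β′} → (∀ i → α i ≡ α′ i) → (∀ i → β i ≡ β′ i) → sparse α β ≡ sparse α′ β′
  sparse-cong α≗α′ β≗β′ = tabulate-cong λ i → tabulate-cong λ j →
    cong₂ (λ a b → (a ∧ δ j i) xor (b ∧ δ j (σ i))) (α≗α′ i) (β≗β′ i)

  dot-sparse : ∀ α β i v → dot (lookup (sparse α β) i) v ≡ (α i ∧ lookup v i) xor (β i ∧ lookup v (σ i))
  dot-sparse α β i v = dot-two-point (lookup (sparse α β) i) v (α i) (β i) i (σ i) (entry-sparse α β i)

  lookup-sparse-· : ∀ α β v i → lookup (sparse α β · v) i ≡ (α i ∧ lookup v i) xor (β i ∧ lookup v (σ i))
  lookup-sparse-· α β v i = trans (lookup-· (sparse α β) v i) (dot-sparse α β i v)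

  entry-sparse-*ᴹ : ∀ α β α′ β′ i j → entry (sparse α β *ᴹ sparse α′ β′) i j ≡
    (((α i ∧ α′ i) xor (β i ∧ β′ (σ i))) ∧ δ j i) xor (((α i ∧ β′ i) xor (β i ∧ α′ (σ i))) ∧ δ j (σ i))
  entry-sparse-*ᴹ α β α′ β′ i j = begin
    entry (sparse α β *ᴹ sparse α′ β′) i j
      ≡⟨ entry-*ᴹ (sparse α β) (sparse α′ β′) i j ⟩
    dot (lookup (sparse α β) i) (lookup (transpose (sparse α′ β′)) j)
      ≡⟨ dot-sparse α β i _ ⟩
    (α i ∧ entry (transpose (sparse α′ β′)) j i) xor (β i ∧ entry (transpose (sparse α′ β′)) j (σ i))
      ≡⟨ cong₂ (λ x y → (α i ∧ x) xor (β i ∧ y)) (column i) (column (σ i)) ⟩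
    (α i ∧ ((α′ i ∧ δ j i) xor (β′ i ∧ δ j (σ i)))) xor
    (β i ∧ ((α′ (σ i) ∧ δ j (σ i)) xor (β′ (σ i) ∧ δ j (σ (σ i)))))
      ≡⟨ cong (λ k → (α i ∧ ((α′ i ∧ δ j i) xor (β′ i ∧ δ j (σ i)))) xor
                     (β i ∧ ((α′ (σ i) ∧ δ j (σ i)) xor (β′ (σ i) ∧ δ j k)))) (σ-involutive i) ⟩
    (α i ∧ ((α′ i ∧ δ j i) xor (β′ i ∧ δ j (σ i)))) xor (β i ∧ ((α′ (σ i) ∧ δ j (σ i)) xor (β′ (σ i) ∧ δ j i)))
      ≡⟨ collect (α i) (β i) (α′ i) (β′ i) (α′ (σ i)) (β′ (σ i)) (δ j i) (δ j (σ i)) ⟩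
    (((α i ∧ α′ i) xor (β i ∧ β′ (σ i))) ∧ δ j i) xor (((α i ∧ β′ i) xor (β i ∧ α′ (σ i))) ∧ δ j (σ i)) ∎
    where
    column : ∀ k → entry (transpose (sparse α′ β′)) j k ≡ (α′ k ∧ δ j k) xor (β′ k ∧ δ j (σ k))
    column k = trans (entry-transpose (sparse α′ β′) j k) (entry-sparse α′ β′ k j)
    collect : ∀ a b a′ b′ a″ b″ e f →
      (a ∧ ((a′ ∧ e) xor (b′ ∧ f))) xor (b ∧ ((a″ ∧ f) xor (b″ ∧ e))) ≡
      (((a ∧ a′) xor (b ∧ b″)) ∧ e) xor (((a ∧ b′) xor (b ∧ a″)) ∧ f)
    collect = solve-∀ F₂

  sparse-*ᴹ : ∀ α β α′ β′ → sparse α β *ᴹ sparse α′ β′ ≡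
    sparse (λ i → (α i ∧ α′ i) xor (β i ∧ β′ (σ i))) (λ i → (α i ∧ β′ i) xor (β i ∧ α′ (σ i)))
  sparse-*ᴹ α β α′ β′ = Matrix-ext _ _ λ i j →
    trans (entry-sparse-*ᴹ α β α′ β′ i j)
          (sym (entry-sparse (λ i → (α i ∧ α′ i) xor (β i ∧ β′ (σ i)))
                             (λ i → (α i ∧ β′ i) xor (β i ∧ α′ (σ i))) i j))

  δ-σ : ∀ i j → δ i (σ j) ≡ δ j (σ i)
  δ-σ i j = does-⇔ (mk⇔ (λ i≡σj → trans (sym (σ-involutive j)) (cong σ (sym i≡σj)))
                         (λ j≡σi → trans (sym (σ-involutive i)) (cong σ (sym j≡σi))))
                   (i ≟ σ j) (j ≟ σ i)

  entry-transpose-sparse : ∀ α β i j → entry (transpose (sparse α β)) i j ≡ (α i ∧ δ j i) xor (β (σ i) ∧ δ j (σ i))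
  entry-transpose-sparse α β i j = begin
    entry (transpose (sparse α β)) i j         ≡⟨ entry-transpose (sparse α β) i j ⟩
    entry (sparse α β) j i                     ≡⟨ entry-sparse α β j i ⟩
    (α j ∧ δ i j) xor (β j ∧ δ i (σ j))        ≡⟨ cong₂ _xor_ diagonal off-diagonal ⟩
    (α i ∧ δ j i) xor (β (σ i) ∧ δ j (σ i))    ∎
    where
    diagonal : α j ∧ δ i j ≡ α i ∧ δ j i
    diagonal = trans (sym (δ-subst α i j)) (cong (α i ∧_) (δ-sym i j))
    off-diagonal : β j ∧ δ i (σ j) ≡ β (σ i) ∧ δ j (σ i)
    off-diagonal = trans (cong (β j ∧_) (δ-σ i j)) (δ-subst β j (σ i))

  transpose-sparse : ∀ α β → transpose (sparse α β) ≡ sparse α (β ∘ σ)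
  transpose-sparse α β = Matrix-ext _ _ λ i j →
    trans (entry-transpose-sparse α β i j) (sym (entry-sparse α (β ∘ σ) i j))

  module _ (i : Fin n) (σ-moves-i : δ i (σ i) ≡ false) where

    entry-sparse-diagonal : ∀ α β → entry (sparse α β) i i ≡ α i
    entry-sparse-diagonal α β = begin
      entry (sparse α β) i i                     ≡⟨ entry-sparse α β i i ⟩
      (α i ∧ δ i i) xor (β i ∧ δ i (σ i))        ≡⟨ cong₂ (λ x y → (α i ∧ x) xor (β i ∧ y)) (δ-refl i) σ-moves-i ⟩
      (α i ∧ true) xor (β i ∧ false)             ≡⟨ simplify (α i) (β i) ⟩
      α i                                        ∎
      where
      simplify : ∀ a b → (a ∧ true) xor (b ∧ false) ≡ a
      simplify = solve-∀ F₂

    entry-sparse-σ : ∀ α β → entry (sparse α β) i (σ i) ≡ β i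
    entry-sparse-σ α β = begin
      entry (sparse α β) i (σ i)                       ≡⟨ entry-sparse α β i (σ i) ⟩
      (α i ∧ δ (σ i) i) xor (β i ∧ δ (σ i) (σ i))      ≡⟨ cong₂ (λ x y → (α i ∧ x) xor (β i ∧ y))
                                                               (trans (δ-sym (σ i) i) σ-moves-i) (δ-refl (σ i)) ⟩
      (α i ∧ false) xor (β i ∧ true)                   ≡⟨ simplify (α i) (β i) ⟩
      β i                                              ∎
      where
      simplify : ∀ a b → (a ∧ false) xor (b ∧ true) ≡ b
      simplify = solve-∀ F₂

-- ℤ₃ and its representation in Sp₂(2)

data ℤ₃ : Set where
  0₃ 1₃ 2₃ : ℤ₃

suc₃ : ℤ₃ → ℤ₃
suc₃ 0₃ = 1₃
suc₃ 1₃ = 2₃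
suc₃ 2₃ = 0₃

infixl 6 _+₃_
_+₃_ : ℤ₃ → ℤ₃ → ℤ₃
0₃ +₃ y = y
1₃ +₃ y = suc₃ y
2₃ +₃ y = suc₃ (suc₃ y)

_≟₃_ : DecidableEquality ℤ₃
0₃ ≟₃ 0₃ = yes refl
0₃ ≟₃ 1₃ = no λ ()
0₃ ≟₃ 2₃ = no λ ()
1₃ ≟₃ 0₃ = no λ ()
1₃ ≟₃ 1₃ = yes refl
1₃ ≟₃ 2₃ = no λ ()
2₃ ≟₃ 0₃ = no λ ()
2₃ ≟₃ 1₃ = no λ ()
2₃ ≟₃ 2₃ = yes refl

suc₃-+₃ : ∀ y z → suc₃ y +₃ z ≡ suc₃ (y +₃ z)
suc₃-+₃ 0₃ z  = refl
suc₃-+₃ 1₃ z  = refl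
suc₃-+₃ 2₃ 0₃ = refl
suc₃-+₃ 2₃ 1₃ = refl
suc₃-+₃ 2₃ 2₃ = refl

+₃-assoc : ∀ x y z → (x +₃ y) +₃ z ≡ x +₃ (y +₃ z)
+₃-assoc 0₃ y z = refl
+₃-assoc 1₃ y z = suc₃-+₃ y z
+₃-assoc 2₃ y z = trans (suc₃-+₃ (suc₃ y) z) (cong suc₃ (suc₃-+₃ y z))

+₃-comm : ∀ x y → x +₃ y ≡ y +₃ x
+₃-comm 0₃ 0₃ = refl
+₃-comm 0₃ 1₃ = refl
+₃-comm 0₃ 2₃ = refl
+₃-comm 1₃ 0₃ = refl
+₃-comm 1₃ 1₃ = refl
+₃-comm 1₃ 2₃ = refl
+₃-comm 2₃ 0₃ = refl
+₃-comm 2₃ 1₃ = refl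
+₃-comm 2₃ 2₃ = refl

+₃-interchange : ∀ a b c e → (a +₃ b) +₃ (c +₃ e) ≡ (a +₃ c) +₃ (b +₃ e)
+₃-interchange a b c e = begin
  (a +₃ b) +₃ (c +₃ e) ≡⟨ +₃-assoc a b (c +₃ e) ⟩
  a +₃ (b +₃ (c +₃ e)) ≡⟨ cong (a +₃_) (+₃-assoc b c e) ⟨
  a +₃ ((b +₃ c) +₃ e) ≡⟨ cong (λ x → a +₃ (x +₃ e)) (+₃-comm b c) ⟩
  a +₃ ((c +₃ b) +₃ e) ≡⟨ cong (a +₃_) (+₃-assoc c b e) ⟩
  a +₃ (c +₃ (b +₃ e)) ≡⟨ +₃-assoc a c (b +₃ e) ⟨
  (a +₃ c) +₃ (b +₃ e) ∎

+₃-cube : ∀ z → z +₃ (z +₃ z) ≡ 0₃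
+₃-cube 0₃ = refl
+₃-cube 1₃ = refl
+₃-cube 2₃ = refl

ℤ₃-elements : List ℤ₃
ℤ₃-elements = 0₃ ∷ 1₃ ∷ 2₃ ∷ []

∈-ℤ₃-elements : ∀ z → z ∈ ℤ₃-elements
∈-ℤ₃-elements 0₃ = here refl
∈-ℤ₃-elements 1₃ = there (here refl)
∈-ℤ₃-elements 2₃ = there (there (here refl))

ℤ₃-elements-unique : Unique ℤ₃-elements
ℤ₃-elements-unique = ((λ ()) ∷ (λ ()) ∷ []) ∷ ((λ ()) ∷ []) ∷ [] ∷ []

fibreParity : ∀ {X : Set} → List X → (X → ℤ₃) → ℤ₃ → Bool
fibreParity xs ψ z = xorSum (map (λ x → does (ψ x ≟₃ z)) xs)

OddFibres : ∀ {X : Set} → List X → (X → ℤ₃) → Set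
OddFibres xs ψ = fibreParity xs ψ 0₃ ≡ true × fibreParity xs ψ 1₃ ≡ true × fibreParity xs ψ 2₃ ≡ true

indicator-expansion : ∀ (f : ℤ₃ → Bool) z →
  f z ≡ ((f 0₃ ∧ does (z ≟₃ 0₃)) xor (f 1₃ ∧ does (z ≟₃ 1₃))) xor (f 2₃ ∧ does (z ≟₃ 2₃))
indicator-expansion f 0₃ = pick₀ (f 0₃) (f 1₃) (f 2₃)
  where
  pick₀ : ∀ a b c → a ≡ ((a ∧ true) xor (b ∧ false)) xor (c ∧ false)
  pick₀ = solve-∀ F₂
indicator-expansion f 1₃ = pick₁ (f 0₃) (f 1₃) (f 2₃)
  where
  pick₁ : ∀ a b c → b ≡ ((a ∧ false) xor (b ∧ true)) xor (c ∧ false)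
  pick₁ = solve-∀ F₂
indicator-expansion f 2₃ = pick₂ (f 0₃) (f 1₃) (f 2₃)
  where
  pick₂ : ∀ a b c → c ≡ ((a ∧ false) xor (b ∧ false)) xor (c ∧ true)
  pick₂ = solve-∀ F₂

xorSum-map-oddFibres : ∀ {X : Set} (xs : List X) ψ → OddFibres xs ψ →
  ∀ f → xorSum (map (f ∘ ψ) xs) ≡ (f 0₃ xor f 1₃) xor f 2₃
xorSum-map-oddFibres xs ψ (odd₀ , odd₁ , odd₂) f = begin
  xorSum (map (f ∘ ψ) xs)
    ≡⟨ cong xorSum (map-cong (indicator-expansion f ∘ ψ) xs) ⟩
  xorSum (map (λ x → ((f 0₃ ∧ [ x ]₀) xor (f 1₃ ∧ [ x ]₁)) xor (f 2₃ ∧ [ x ]₂)) xs)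
    ≡⟨ xorSum-map-xor (λ x → (f 0₃ ∧ [ x ]₀) xor (f 1₃ ∧ [ x ]₁)) (λ x → f 2₃ ∧ [ x ]₂) xs ⟩
  xorSum (map (λ x → (f 0₃ ∧ [ x ]₀) xor (f 1₃ ∧ [ x ]₁)) xs) xor xorSum (map (λ x → f 2₃ ∧ [ x ]₂) xs)
    ≡⟨ cong (_xor xorSum (map (λ x → f 2₃ ∧ [ x ]₂) xs))
            (xorSum-map-xor (λ x → f 0₃ ∧ [ x ]₀) (λ x → f 1₃ ∧ [ x ]₁) xs) ⟩
  (xorSum (map (λ x → f 0₃ ∧ [ x ]₀) xs) xor xorSum (map (λ x → f 1₃ ∧ [ x ]₁) xs)) xor
  xorSum (map (λ x → f 2₃ ∧ [ x ]₂) xs)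
    ≡⟨ cong₂ _xor_ (cong₂ _xor_ (weight 0₃ odd₀) (weight 1₃ odd₁)) (weight 2₃ odd₂) ⟩
  (f 0₃ xor f 1₃) xor f 2₃ ∎
  where
  [_]₀ [_]₁ [_]₂ : _ → Bool
  [ x ]₀ = does (ψ x ≟₃ 0₃)
  [ x ]₁ = does (ψ x ≟₃ 1₃)
  [ x ]₂ = does (ψ x ≟₃ 2₃)
  weight : ∀ z → fibreParity xs ψ z ≡ true → xorSum (map (λ x → f z ∧ does (ψ x ≟₃ z)) xs) ≡ f z
  weight z odd = trans (xorSum-map-∧ (f z) (λ x → does (ψ x ≟₃ z)) xs)
                       (trans (cong (f z ∧_) odd) (∧-identityʳ (f z)))

ρ : ℤ₃ → Matrix 2
ρ 0₃ = identity
ρ 1₃ = (false ∷ true ∷ []) ∷ (true ∷ true  ∷ []) ∷ []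
ρ 2₃ = (true  ∷ true ∷ []) ∷ (true ∷ false ∷ []) ∷ []

ρ-+₃ : ∀ z w → ρ (z +₃ w) ≡ ρ z *ᴹ ρ w
ρ-+₃ 0₃ 0₃ = refl
ρ-+₃ 0₃ 1₃ = refl
ρ-+₃ 0₃ 2₃ = refl
ρ-+₃ 1₃ 0₃ = refl
ρ-+₃ 1₃ 1₃ = refl
ρ-+₃ 1₃ 2₃ = refl
ρ-+₃ 2₃ 0₃ = refl
ρ-+₃ 2₃ 1₃ = refl
ρ-+₃ 2₃ 2₃ = refl

ρ-symplectic : ∀ z → IsSymplectic 1 (ρ z)
ρ-symplectic 0₃ = refl
ρ-symplectic 1₃ = refl
ρ-symplectic 2₃ = refl

ρ-injective : ∀ {z w} → ρ z ≡ ρ w → z ≡ w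
ρ-injective {0₃} {0₃} _  = refl
ρ-injective {0₃} {1₃} ()
ρ-injective {0₃} {2₃} ()
ρ-injective {1₃} {0₃} ()
ρ-injective {1₃} {1₃} _  = refl
ρ-injective {1₃} {2₃} ()
ρ-injective {2₃} {0₃} ()
ρ-injective {2₃} {1₃} ()
ρ-injective {2₃} {2₃} _  = refl

-- Block diagonal matrices in Sp_{2d}(2)

module Blocks (d : ℕ) where

  σ : Fin (d + d) → Fin (d + d)
  σ i = join d d (swap (splitAt d i))

  splitAt-σ : ∀ i → splitAt d (σ i) ≡ swap (splitAt d i)
  splitAt-σ i = splitAt-join d d (swap (splitAt d i))

  σ-involutive : ∀ i → σ (σ i) ≡ i
  σ-involutive i = begin
    join d d (swap (splitAt d (σ i)))    ≡⟨ cong (join d d ∘ swap) (splitAt-σ i) ⟩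
    join d d (swap (swap (splitAt d i))) ≡⟨ cong (join d d) (swap-involutive (splitAt d i)) ⟩
    join d d (splitAt d i)               ≡⟨ join-splitAt d d i ⟩
    i                                    ∎

  open Sparse σ σ-involutive

  _≟⊎_ : DecidableEquality (Fin d ⊎ Fin d)
  _≟⊎_ = ≡-dec _≟_ _≟_

  δ-splitAt : ∀ i j → δ i j ≡ does (splitAt d i ≟⊎ splitAt d j)
  δ-splitAt i j = does-⇔ (mk⇔ (cong (splitAt d)) splitAt-injective) (i ≟ j) (splitAt d i ≟⊎ splitAt d j)
    where
    splitAt-injective : splitAt d i ≡ splitAt d j → i ≡ j
    splitAt-injective eq = trans (sym (join-splitAt d d i)) (trans (cong (join d d) eq) (join-splitAt d d j))

  δ-σ-false : ∀ i → δ i (σ i) ≡ false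
  δ-σ-false i = begin
    δ i (σ i)                                      ≡⟨ δ-splitAt i (σ i) ⟩
    does (splitAt d i ≟⊎ splitAt d (σ i))          ≡⟨ cong (does ∘ (splitAt d i ≟⊎_)) (splitAt-σ i) ⟩
    does (splitAt d i ≟⊎ swap (splitAt d i))       ≡⟨ differs (splitAt d i) ⟩
    false                                          ∎
    where
    differs : ∀ x → does (x ≟⊎ swap x) ≡ false
    differs (inj₁ _) = refl
    differs (inj₂ _) = refl

  slot : Fin d ⊎ Fin d → Fin 2
  slot (inj₁ _) = zero
  slot (inj₂ _) = suc zero

  blockEntry : (Fin d → Matrix 2) → Fin d ⊎ Fin d → Fin d ⊎ Fin d → Bool
  blockEntry B x y = entry (B (reduce x)) (slot x) (slot y)

  diagonal offDiagonal : (Fin d → Matrix 2) → Fin (d + d) → Bool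
  diagonal    B i = blockEntry B (splitAt d i) (splitAt d i)
  offDiagonal B i = blockEntry B (splitAt d i) (swap (splitAt d i))

  -- The coordinates k and d + k span the k-th block, on which blockDiag B acts as B k.
  blockDiag : (Fin d → Matrix 2) → Matrix (d + d)
  blockDiag B = sparse (diagonal B) (offDiagonal B)

  entry-blockDiag : ∀ B i j → entry (blockDiag B) i j ≡ (diagonal B i ∧ δ j i) xor (offDiagonal B i ∧ δ j (σ i))
  entry-blockDiag B = entry-sparse (diagonal B) (offDiagonal B)

  blockDiag-cong : ∀ {B C} → (∀ k → B k ≡ C k) → blockDiag B ≡ blockDiag C
  blockDiag-cong {B} {C} B≗C = sparse-cong (λ i → same (splitAt d i) (splitAt d i))
                                           (λ i → same (splitAt d i) (swap (splitAt d i)))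
    where
    same : ∀ x y → blockEntry B x y ≡ blockEntry C x y
    same x y = cong (λ M → entry M (slot x) (slot y)) (B≗C (reduce x))

  diagonal-σ : ∀ B i → diagonal B (σ i) ≡ blockEntry B (swap (splitAt d i)) (swap (splitAt d i))
  diagonal-σ B i = cong₂ (blockEntry B) (splitAt-σ i) (splitAt-σ i)

  offDiagonal-σ : ∀ B i → offDiagonal B (σ i) ≡ blockEntry B (swap (splitAt d i)) (splitAt d i)
  offDiagonal-σ B i =
    cong₂ (blockEntry B) (splitAt-σ i) (trans (cong swap (splitAt-σ i)) (swap-involutive (splitAt d i)))

  blockEntry-*ᴹ : ∀ B C x y →
    (blockEntry B x x ∧ blockEntry C x y) xor (blockEntry B x (swap x) ∧ blockEntry C (swap x) y) ≡
    blockEntry (λ k → B k *ᴹ C k) x y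
  blockEntry-*ᴹ B C (inj₁ k) y = sym (entry-*ᴹ₂ (B k) (C k) zero (slot y))
  blockEntry-*ᴹ B C (inj₂ k) y =
    trans (xor-comm (entry (B k) (suc zero) (suc zero) ∧ entry (C k) (suc zero) (slot y))
                    (entry (B k) (suc zero) zero ∧ entry (C k) zero (slot y)))
          (sym (entry-*ᴹ₂ (B k) (C k) (suc zero) (slot y)))

  blockDiag-*ᴹ : ∀ B C → blockDiag B *ᴹ blockDiag C ≡ blockDiag (λ k → B k *ᴹ C k)
  blockDiag-*ᴹ B C = trans (sparse-*ᴹ (diagonal B) (offDiagonal B) (diagonal C) (offDiagonal C))
                           (sparse-cong on-diagonal off-diagonal)
    where
    on-diagonal : ∀ i → (diagonal B i ∧ diagonal C i) xor (offDiagonal B i ∧ offDiagonal C (σ i)) ≡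
                        diagonal (λ k → B k *ᴹ C k) i
    on-diagonal i = trans (cong (λ b → (diagonal B i ∧ diagonal C i) xor (offDiagonal B i ∧ b))
                                (offDiagonal-σ C i))
                          (blockEntry-*ᴹ B C (splitAt d i) (splitAt d i))
    off-diagonal : ∀ i → (diagonal B i ∧ offDiagonal C i) xor (offDiagonal B i ∧ diagonal C (σ i)) ≡
                         offDiagonal (λ k → B k *ᴹ C k) i
    off-diagonal i = trans (cong (λ a → (diagonal B i ∧ offDiagonal C i) xor (offDiagonal B i ∧ a))
                                 (diagonal-σ C i))
                           (blockEntry-*ᴹ B C (splitAt d i) (swap (splitAt d i)))

  transpose-blockDiag : ∀ B → transpose (blockDiag B) ≡ blockDiag (transpose ∘ B)
  transpose-blockDiag B = trans (transpose-sparse (diagonal B) (offDiagonal B))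
                                (sparse-cong on-diagonal off-diagonal)
    where
    on-diagonal : ∀ i → diagonal B i ≡ diagonal (transpose ∘ B) i
    on-diagonal i = sym (entry-transpose (B (reduce (splitAt d i))) _ _)
    transposed : ∀ x → blockEntry B (swap x) x ≡ blockEntry (transpose ∘ B) x (swap x)
    transposed (inj₁ k) = sym (entry-transpose (B k) zero (suc zero))
    transposed (inj₂ k) = sym (entry-transpose (B k) (suc zero) zero)
    off-diagonal : ∀ i → offDiagonal B (σ i) ≡ offDiagonal (transpose ∘ B) i
    off-diagonal i = trans (offDiagonal-σ B i) (transposed (splitAt d i))

  entry-J : ∀ i j → entry (J d) i j ≡ δ j (σ i)
  entry-J i j = trans (J-sides i j)
                      (sym (trans (δ-splitAt j (σ i)) (cong (does ∘ (splitAt d j ≟⊎_)) (splitAt-σ i))))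
    where
    J-sides : ∀ i j → entry (J d) i j ≡ does (splitAt d j ≟⊎ swap (splitAt d i))
    J-sides i j with e ← (entry (J d) i j ≡ _) ∋ entry-tabulate _ i j with splitAt d i | splitAt d j
    ... | inj₁ a | inj₁ b = e
    ... | inj₁ a | inj₂ b = trans e (δ-sym a b)
    ... | inj₂ a | inj₁ b = trans e (δ-sym a b)
    ... | inj₂ a | inj₂ b = e

  J-blockDiag : J d ≡ blockDiag (λ _ → J 1)
  J-blockDiag = Matrix-ext _ _ λ i j → begin
    entry (J d) i j                         ≡⟨ entry-J i j ⟩
    (false ∧ δ j i) xor (true ∧ δ j (σ i))  ≡⟨ cong₂ (λ a b → (a ∧ δ j i) xor (b ∧ δ j (σ i)))
                                                    (J-diagonal (splitAt d i)) (J-offDiagonal (splitAt d i)) ⟨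
    (diagonal (λ _ → J 1) i ∧ δ j i) xor (offDiagonal (λ _ → J 1) i ∧ δ j (σ i))
                                            ≡⟨ entry-blockDiag (λ _ → J 1) i j ⟨
    entry (blockDiag (λ _ → J 1)) i j       ∎
    where
    J-diagonal : ∀ x → blockEntry (λ _ → J 1) x x ≡ false
    J-diagonal (inj₁ _) = refl
    J-diagonal (inj₂ _) = refl
    J-offDiagonal : ∀ x → blockEntry (λ _ → J 1) x (swap x) ≡ true
    J-offDiagonal (inj₁ _) = refl
    J-offDiagonal (inj₂ _) = refl

  identity-blockDiag : identity ≡ blockDiag (λ _ → identity)
  identity-blockDiag = Matrix-ext _ _ λ i j → begin
    entry identity i j                      ≡⟨ trans (entry-identity i j) (δ-sym i j) ⟩
    δ j i                                   ≡⟨ xor-identityʳ (δ j i) ⟨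
    (true ∧ δ j i) xor (false ∧ δ j (σ i))  ≡⟨ cong₂ (λ a b → (a ∧ δ j i) xor (b ∧ δ j (σ i)))
                                                    (one-diagonal (splitAt d i)) (one-offDiagonal (splitAt d i)) ⟨
    (diagonal (λ _ → identity) i ∧ δ j i) xor (offDiagonal (λ _ → identity) i ∧ δ j (σ i))
                                            ≡⟨ entry-blockDiag (λ _ → identity) i j ⟨
    entry (blockDiag (λ _ → identity)) i j  ∎
    where
    one-diagonal : ∀ x → blockEntry (λ _ → identity) x x ≡ true
    one-diagonal (inj₁ _) = refl
    one-diagonal (inj₂ _) = refl
    one-offDiagonal : ∀ x → blockEntry (λ _ → identity) x (swap x) ≡ false
    one-offDiagonal (inj₁ _) = refl
    one-offDiagonal (inj₂ _) = refl

  blockDiag-symplectic : ∀ B → (∀ k → IsSymplectic 1 (B k)) → IsSymplectic d (blockDiag B)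
  blockDiag-symplectic B B-symplectic = begin
    transpose (blockDiag B) *ᴹ (J d *ᴹ blockDiag B)
      ≡⟨ cong₂ (λ X Y → X *ᴹ (Y *ᴹ blockDiag B)) (transpose-blockDiag B) J-blockDiag ⟩
    blockDiag (transpose ∘ B) *ᴹ (blockDiag (λ _ → J 1) *ᴹ blockDiag B)
      ≡⟨ cong (blockDiag (transpose ∘ B) *ᴹ_) (blockDiag-*ᴹ (λ _ → J 1) B) ⟩
    blockDiag (transpose ∘ B) *ᴹ blockDiag (λ k → J 1 *ᴹ B k)
      ≡⟨ blockDiag-*ᴹ (transpose ∘ B) (λ k → J 1 *ᴹ B k) ⟩
    blockDiag (λ k → transpose (B k) *ᴹ (J 1 *ᴹ B k))
      ≡⟨ blockDiag-cong B-symplectic ⟩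
    blockDiag (λ _ → J 1)
      ≡⟨ J-blockDiag ⟨
    J d ∎

  entry-blockDiag-diagonal : ∀ B i → entry (blockDiag B) i i ≡ diagonal B i
  entry-blockDiag-diagonal B i = entry-sparse-diagonal i (δ-σ-false i) (diagonal B) (offDiagonal B)

  entry-blockDiag-σ : ∀ B i → entry (blockDiag B) i (σ i) ≡ offDiagonal B i
  entry-blockDiag-σ B i = entry-sparse-σ i (δ-σ-false i) (diagonal B) (offDiagonal B)

  blockDiag-injective : ∀ {B C} → blockDiag B ≡ blockDiag C → ∀ k → B k ≡ C k
  blockDiag-injective {B} {C} B≡C k = Matrix-ext (B k) (C k) entries
    where
    same-diagonal : ∀ i → diagonal B i ≡ diagonal C i
    same-diagonal i = trans (sym (entry-blockDiag-diagonal B i))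
                            (trans (cong (λ M → entry M i i) B≡C) (entry-blockDiag-diagonal C i))
    same-offDiagonal : ∀ i → offDiagonal B i ≡ offDiagonal C i
    same-offDiagonal i = trans (sym (entry-blockDiag-σ B i))
                               (trans (cong (λ M → entry M i (σ i)) B≡C) (entry-blockDiag-σ C i))
    on : ∀ x → blockEntry B x x ≡ blockEntry C x x
    on x = subst (λ y → blockEntry B y y ≡ blockEntry C y y) (splitAt-join d d x) (same-diagonal (join d d x))
    off : ∀ x → blockEntry B x (swap x) ≡ blockEntry C x (swap x)
    off x = subst (λ y → blockEntry B y (swap y) ≡ blockEntry C y (swap y)) (splitAt-join d d x)
                  (same-offDiagonal (join d d x))
    entries : ∀ s t → entry (B k) s t ≡ entry (C k) s t
    entries zero       zero       = on (inj₁ k)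
    entries zero       (suc zero) = off (inj₁ k)
    entries (suc zero) zero       = off (inj₂ k)
    entries (suc zero) (suc zero) = on (inj₂ k)

  det-blockDiag+identity : ∀ B k → B k ≡ identity → det (blockDiag B +ᴹ identity) ≡ false
  det-blockDiag+identity B k Bk≡1 = det-+ᴹ-equal-rows (blockDiag B) identity i λ j → begin
    entry (blockDiag B) i j                                  ≡⟨ entry-blockDiag B i j ⟩
    (diagonal B i ∧ δ j i) xor (offDiagonal B i ∧ δ j (σ i)) ≡⟨ cong₂ (λ a b → (a ∧ δ j i) xor (b ∧ δ j (σ i)))
                                                                     diagonal-i offDiagonal-i ⟩
    (true ∧ δ j i) xor (false ∧ δ j (σ i))                   ≡⟨ xor-identityʳ (δ j i) ⟩
    δ j i                                                    ≡⟨ trans (δ-sym j i) (sym (entry-identity i j)) ⟩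
    entry identity i j                                       ∎
    where
    i = k ↑ˡ d
    split : splitAt d i ≡ inj₁ k
    split = splitAt-↑ˡ d k d
    diagonal-i : diagonal B i ≡ true
    diagonal-i = trans (cong (λ x → blockEntry B x x) split) (cong (λ M → entry M zero zero) Bk≡1)
    offDiagonal-i : offDiagonal B i ≡ false
    offDiagonal-i = trans (cong (λ x → blockEntry B x (swap x)) split)
                          (cong (λ M → entry M zero (suc zero)) Bk≡1)

  lookup-blockDiag-· : ∀ B v i →
    lookup (blockDiag B · v) i ≡ (diagonal B i ∧ lookup v i) xor (offDiagonal B i ∧ lookup v (σ i))
  lookup-blockDiag-· B = lookup-sparse-· (diagonal B) (offDiagonal B)

  -- Coordinate x of (ρ z − 1) v, where v has entry a at x and b at the other coordinate of its block.
  ρ-defect : Fin d ⊎ Fin d → Bool → Bool → ℤ₃ → Bool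
  ρ-defect x a b z = ((blockEntry (λ _ → ρ z) x x ∧ a) xor (blockEntry (λ _ → ρ z) x (swap x) ∧ b)) xor a

  -- 1 + ρ 1₃ + ρ 2₃ = 0, so the three defects add up to −3a = a.
  ∑-ρ-defect : ∀ x a b → (ρ-defect x a b 0₃ xor ρ-defect x a b 1₃) xor ρ-defect x a b 2₃ ≡ a
  ∑-ρ-defect (inj₁ _) false false = refl
  ∑-ρ-defect (inj₁ _) false true  = refl
  ∑-ρ-defect (inj₁ _) true  false = refl
  ∑-ρ-defect (inj₁ _) true  true  = refl
  ∑-ρ-defect (inj₂ _) false false = refl
  ∑-ρ-defect (inj₂ _) false true  = refl
  ∑-ρ-defect (inj₂ _) true  false = refl
  ∑-ρ-defect (inj₂ _) true  true  = refl

-- Subgroups of Sp_{2d}(2) from families of characters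

FixedPointExp3Subgroup : ℕ → ℕ → Set₁
FixedPointExp3Subgroup d m =
  Σ (List (Matrix (d + d))) λ G →
    IsSubgroupOfSp d G × IsFixedPointSubgroup G × HasOrder G m × HasExponent3 G × ¬ HasTrivialCompositionFactor G

module FromCharacters {d : ℕ} {X : Set} (_∙_ : X → X → X) (ε : X) (∙-cube : ∀ x → x ∙ (x ∙ x) ≡ ε)
                      (χ : X → Fin d → ℤ₃) (χ-∙ : ∀ x y k → χ (x ∙ y) k ≡ χ x k +₃ χ y k) where

  open Blocks d

  Separating : Set
  Separating = ∀ x y → (∀ k → χ x k ≡ χ y k) → x ≡ y

  KernelsCover : Set
  KernelsCover = ∀ x → ∃ λ k → χ x k ≡ 0₃

  represent : X → Matrix (d + d)
  represent x = blockDiag (ρ ∘ χ x)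

  represent-∙ : ∀ x y → represent (x ∙ y) ≡ represent x *ᴹ represent y
  represent-∙ x y = begin
    blockDiag (ρ ∘ χ (x ∙ y))                ≡⟨ blockDiag-cong (λ k → trans (cong ρ (χ-∙ x y k))
                                                                           (ρ-+₃ (χ x k) (χ y k))) ⟩
    blockDiag (λ k → ρ (χ x k) *ᴹ ρ (χ y k)) ≡⟨ blockDiag-*ᴹ (ρ ∘ χ x) (ρ ∘ χ y) ⟨
    represent x *ᴹ represent y               ∎

  χ-ε : ∀ k → χ ε k ≡ 0₃
  χ-ε k = begin
    χ ε k                     ≡⟨ cong (λ x → χ x k) (∙-cube ε) ⟨
    χ (ε ∙ (ε ∙ ε)) k         ≡⟨ trans (χ-∙ ε (ε ∙ ε) k) (cong (χ ε k +₃_) (χ-∙ ε ε k)) ⟩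
    χ ε k +₃ (χ ε k +₃ χ ε k) ≡⟨ +₃-cube (χ ε k) ⟩
    0₃                        ∎

  represent-ε : represent ε ≡ identity
  represent-ε = trans (blockDiag-cong (λ k → cong ρ (χ-ε k))) (sym identity-blockDiag)

  represent-inverse : ∀ x → represent x *ᴹ represent (x ∙ x) ≡ identity
  represent-inverse x = trans (sym (represent-∙ x (x ∙ x))) (trans (cong represent (∙-cube x)) represent-ε)

  represent-injective : Separating → ∀ {x y} → represent x ≡ represent y → x ≡ y
  represent-injective separating {x} {y} eq =
    separating x y (λ k → ρ-injective (blockDiag-injective {ρ ∘ χ x} {ρ ∘ χ y} eq k))

  module _ (elements : List X) where

    G : List (Matrix (d + d))
    G = map represent elements

    isSubgroupOfSp : (∀ x → x ∈ elements) → IsSubgroupOfSp d G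
    isSubgroupOfSp ∈-elements = symplectic , identity-∈ , closed , inverses
      where
      represent-∈ : ∀ x → represent x ∈ G
      represent-∈ x = ∈-map⁺ represent (∈-elements x)
      identity-∈ : identity ∈ G
      identity-∈ = subst (_∈ G) represent-ε (represent-∈ ε)
      symplectic : ∀ {g} → g ∈ G → IsSymplectic d g
      symplectic g∈G with x , _ , refl ← ∈-map⁻ represent g∈G = blockDiag-symplectic (ρ ∘ χ x) (ρ-symplectic ∘ χ x)
      closed : ∀ {g h} → g ∈ G → h ∈ G → (g *ᴹ h) ∈ G
      closed g∈G h∈G with x , _ , refl ← ∈-map⁻ represent g∈G | y , _ , refl ← ∈-map⁻ represent h∈G =
        subst (_∈ G) (represent-∙ x y) (represent-∈ (x ∙ y))
      inverses : ∀ {g} → g ∈ G → ∃ λ h → h ∈ G × (g *ᴹ h) ≡ identity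
      inverses g∈G with x , _ , refl ← ∈-map⁻ represent g∈G =
        represent (x ∙ x) , represent-∈ (x ∙ x) , represent-inverse x

    isFixedPointSubgroup : KernelsCover → IsFixedPointSubgroup G
    isFixedPointSubgroup kernels-cover g∈G
      with x , _ , refl ← ∈-map⁻ represent g∈G with k , χxk≡0 ← kernels-cover x =
      det-blockDiag+identity (ρ ∘ χ x) k (cong ρ χxk≡0)

    hasOrder : Unique elements → Separating → HasOrder G (length elements)
    hasOrder unique separating = map⁺ (represent-injective separating) unique , length-map represent elements

    hasExponent3 : (∀ x → x ∈ elements) → (Σ X λ x → Σ (Fin d) λ k → χ x k ≢ 0₃) → HasExponent3 G
    hasExponent3 ∈-elements (x , k , χxk≢0) = cube , represent x , ∈-map⁺ represent (∈-elements x) , nontrivial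
      where
      cube : ∀ {g} → g ∈ G → (g *ᴹ (g *ᴹ g)) ≡ identity
      cube g∈G with y , _ , refl ← ∈-map⁻ represent g∈G =
        trans (cong (represent y *ᴹ_) (sym (represent-∙ y y))) (represent-inverse y)
      nontrivial : represent x ≢ identity
      nontrivial x≡1 =
        χxk≢0 (ρ-injective (blockDiag-injective {ρ ∘ χ x} {λ _ → identity} (trans x≡1 identity-blockDiag) k))

    ¬trivialFactor : (∀ k → OddFibres elements (λ x → χ x k)) → ¬ HasTrivialCompositionFactor G
    ¬trivialFactor odd = augmentationSum≡id⇒¬trivialFactor G λ w → Vec-ext _ w (coordinate w)
      where
      coordinate : ∀ w i → lookup (augmentationSum G w) i ≡ lookup w i
      coordinate w i = begin
        lookup (augmentationSum G w) i
          ≡⟨ lookup-augmentationSum G w i ⟩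
        xorSum (map (λ g → lookup (g · w) i xor lookup w i) G)
          ≡⟨ cong xorSum (map-∘ elements) ⟨
        xorSum (map (λ x → lookup (represent x · w) i xor lookup w i) elements)
          ≡⟨ cong xorSum (map-cong (λ x → cong (_xor lookup w i) (lookup-blockDiag-· (ρ ∘ χ x) w i)) elements) ⟩
        xorSum (map (defect ∘ (λ x → χ x (reduce (splitAt d i)))) elements)
          ≡⟨ xorSum-map-oddFibres elements (λ x → χ x (reduce (splitAt d i))) (odd (reduce (splitAt d i))) defect ⟩
        (defect 0₃ xor defect 1₃) xor defect 2₃
          ≡⟨ ∑-ρ-defect (splitAt d i) (lookup w i) (lookup w (σ i)) ⟩
        lookup w i ∎
        where
        defect : ℤ₃ → Bool
        defect = ρ-defect (splitAt d i) (lookup w i) (lookup w (σ i))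

    fixedPointExp3Subgroup :
      (∀ x → x ∈ elements) → Unique elements → Separating → (Σ X λ x → Σ (Fin d) λ k → χ x k ≢ 0₃) →
      KernelsCover → (∀ k → OddFibres elements (λ x → χ x k)) →
      FixedPointExp3Subgroup d (length elements)
    fixedPointExp3Subgroup ∈-elements unique separating nontrivial kernels-cover odd =
      G , isSubgroupOfSp ∈-elements , isFixedPointSubgroup kernels-cover , hasOrder unique separating ,
      hasExponent3 ∈-elements nontrivial , ¬trivialFactor odd

-- The groups ℤ₃² and ℤ₃² × ℤ₃

_⊞_ : ℤ₃ × ℤ₃ → ℤ₃ × ℤ₃ → ℤ₃ × ℤ₃
_⊞_ = zip′ _+₃_ _+₃_

⊞-cube : ∀ x → x ⊞ (x ⊞ x) ≡ (0₃ , 0₃)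
⊞-cube (a , b) = cong₂ _,_ (+₃-cube a) (+₃-cube b)

ℤ₃²-elements : List (ℤ₃ × ℤ₃)
ℤ₃²-elements = cartesianProduct ℤ₃-elements ℤ₃-elements

∈-ℤ₃²-elements : ∀ x → x ∈ ℤ₃²-elements
∈-ℤ₃²-elements (a , b) = ∈-cartesianProduct⁺ (∈-ℤ₃-elements a) (∈-ℤ₃-elements b)

ℤ₃²-elements-unique : Unique ℤ₃²-elements
ℤ₃²-elements-unique = cartesianProduct⁺ ℤ₃-elements-unique ℤ₃-elements-unique

line : Fin 4 → ℤ₃ × ℤ₃ → ℤ₃
line zero                   (a , b) = a
line (suc zero)             (a , b) = b
line (suc (suc zero))       (a , b) = a +₃ b
line (suc (suc (suc zero))) (a , b) = a +₃ (b +₃ b)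

line-⊞ : ∀ k x y → line k (x ⊞ y) ≡ line k x +₃ line k y
line-⊞ zero                   (a , b) (a′ , b′) = refl
line-⊞ (suc zero)             (a , b) (a′ , b′) = refl
line-⊞ (suc (suc zero))       (a , b) (a′ , b′) = +₃-interchange a a′ b b′
line-⊞ (suc (suc (suc zero))) (a , b) (a′ , b′) =
  trans (cong ((a +₃ a′) +₃_) (+₃-interchange b b′ b b′)) (+₃-interchange a a′ (b +₃ b) (b′ +₃ b′))

line-kernels-cover : ∀ x → ∃ λ k → line k x ≡ 0₃
line-kernels-cover (0₃ , _ ) = zero , refl
line-kernels-cover (1₃ , 0₃) = suc zero , refl
line-kernels-cover (2₃ , 0₃) = suc zero , refl
line-kernels-cover (1₃ , 2₃) = suc (suc zero) , refl
line-kernels-cover (2₃ , 1₃) = suc (suc zero) , refl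
line-kernels-cover (1₃ , 1₃) = suc (suc (suc zero)) , refl
line-kernels-cover (2₃ , 2₃) = suc (suc (suc zero)) , refl

lines-separate : ∀ x y → (∀ k → line k x ≡ line k y) → x ≡ y
lines-separate (a , b) (a′ , b′) same = cong₂ _,_ (same zero) (same (suc zero))

line-oddFibres : ∀ k → OddFibres ℤ₃²-elements (line k)
line-oddFibres zero                   = refl , refl , refl
line-oddFibres (suc zero)             = refl , refl , refl
line-oddFibres (suc (suc zero))       = refl , refl , refl
line-oddFibres (suc (suc (suc zero))) = refl , refl , refl

_⊞′_ : (ℤ₃ × ℤ₃) × ℤ₃ → (ℤ₃ × ℤ₃) × ℤ₃ → (ℤ₃ × ℤ₃) × ℤ₃
_⊞′_ = zip′ _⊞_ _+₃_

⊞′-cube : ∀ x → x ⊞′ (x ⊞′ x) ≡ ((0₃ , 0₃) , 0₃)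
⊞′-cube (p , c) = cong₂ _,_ (⊞-cube p) (+₃-cube c)

ℤ₃³-elements : List ((ℤ₃ × ℤ₃) × ℤ₃)
ℤ₃³-elements = cartesianProduct ℤ₃²-elements ℤ₃-elements

∈-ℤ₃³-elements : ∀ x → x ∈ ℤ₃³-elements
∈-ℤ₃³-elements (p , c) = ∈-cartesianProduct⁺ (∈-ℤ₃²-elements p) (∈-ℤ₃-elements c)

ℤ₃³-elements-unique : Unique ℤ₃³-elements
ℤ₃³-elements-unique = cartesianProduct⁺ ℤ₃²-elements-unique ℤ₃-elements-unique

wideCharacter : ∀ {n} → (ℤ₃ × ℤ₃) × ℤ₃ → Fin 4 ⊎ Fin n → ℤ₃
wideCharacter (p , c) = [ (λ l → line l p) , (λ _ → c) ]′

wideCharacter-⊞′ : ∀ {n} x y (s : Fin 4 ⊎ Fin n) →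
  wideCharacter (x ⊞′ y) s ≡ wideCharacter x s +₃ wideCharacter y s
wideCharacter-⊞′ (p , c) (p′ , c′) (inj₁ l) = line-⊞ l p p′
wideCharacter-⊞′ (p , c) (p′ , c′) (inj₂ _) = refl

wideCharacter-oddFibres : ∀ {n} (s : Fin 4 ⊎ Fin n) → OddFibres ℤ₃³-elements (λ x → wideCharacter x s)
wideCharacter-oddFibres (inj₁ zero)                   = refl , refl , refl
wideCharacter-oddFibres (inj₁ (suc zero))             = refl , refl , refl
wideCharacter-oddFibres (inj₁ (suc (suc zero)))       = refl , refl , refl
wideCharacter-oddFibres (inj₁ (suc (suc (suc zero)))) = refl , refl , refl
wideCharacter-oddFibres (inj₂ _)                      = refl , refl , refl

subgroup-of-order-9 : FixedPointExp3Subgroup 4 9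
subgroup-of-order-9 =
  fixedPointExp3Subgroup ℤ₃²-elements ∈-ℤ₃²-elements ℤ₃²-elements-unique lines-separate
    ((1₃ , 0₃) , zero , λ ()) line-kernels-cover line-oddFibres
  where open FromCharacters _⊞_ (0₃ , 0₃) ⊞-cube (λ x k → line k x) (λ x y k → line-⊞ k x y)

subgroup-of-order-27 : ∀ m → FixedPointExp3Subgroup (4 + suc m) 27
subgroup-of-order-27 m =
  fixedPointExp3Subgroup ℤ₃³-elements ∈-ℤ₃³-elements ℤ₃³-elements-unique separating
    (((1₃ , 0₃) , 0₃) , zero , λ ()) kernels-cover (wideCharacter-oddFibres ∘ splitAt 4)
  where
  χ : (ℤ₃ × ℤ₃) × ℤ₃ → Fin (4 + suc m) → ℤ₃
  χ x k = wideCharacter x (splitAt 4 k)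
  open FromCharacters _⊞′_ ((0₃ , 0₃) , 0₃) ⊞′-cube χ (λ x y k → wideCharacter-⊞′ x y (splitAt 4 k))
  χ-line : ∀ x l → χ x (l ↑ˡ suc m) ≡ line l (proj₁ x)
  χ-line x l = cong (wideCharacter x) (splitAt-↑ˡ 4 l (suc m))
  χ-last : ∀ x → χ x (4 ↑ʳ zero) ≡ proj₂ x
  χ-last x = cong (wideCharacter x) (splitAt-↑ʳ 4 (suc m) zero)
  kernels-cover : KernelsCover
  kernels-cover x with l , line≡0 ← line-kernels-cover (proj₁ x) = l ↑ˡ suc m , trans (χ-line x l) line≡0
  separating : Separating
  separating x y same = cong₂ _,_
    (lines-separate (proj₁ x) (proj₁ y) λ l →
       trans (sym (χ-line x l)) (trans (same (l ↑ˡ suc m)) (χ-line y l)))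
    (trans (sym (χ-last x)) (trans (same (4 ↑ʳ zero)) (χ-last y)))

corollary4p2 :
  ((d : ℕ) → 4 < d →
    Σ (List (Matrix (d + d))) λ G →
      IsSubgroupOfSp d G × IsFixedPointSubgroup G × HasOrder G 27 ×
      HasExponent3 G × ¬ HasTrivialCompositionFactor G)
  ×
  (Σ (List (Matrix (4 + 4))) λ G →
      IsSubgroupOfSp 4 G × IsFixedPointSubgroup G × HasOrder G 9 ×
      HasExponent3 G × ¬ HasTrivialCompositionFactor G)
corollary4p2 = large , subgroup-of-order-9
  where
  large : (d : ℕ) → 4 < d → FixedPointExp3Subgroup d 27
  large (suc (suc (suc (suc (suc m))))) (s≤s (s≤s (s≤s (s≤s (s≤s _))))) = subgroup-of-order-27 m
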